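{- Let $p$ be a prime. The intersection graph $\Gamma(D_{2p^2})$ is a split graph.
   Context: $D_{2n}=\langle r,s : r^n=s^2=1,\ srs=r^{ -1}\rangle$ is the dihedral group of order $2n$. The intersection graph $\Gamma(G)$ of a finite group $G$ has as vertices the proper non-trivial subgroups of $G$, two distinct vertices being adjacent iff their intersection is non-trivial. A graph is split if its vertex set can be partitioned into an independent set and a set inducing a complete graph. -}

module Defs where

open import Data.Nat using (ℕ; zero; suc; _+_; _∸_)
open import Data.Nat.DivMod using (_%_; m%n<n)
open import Data.Fin using (Fin; toℕ; fromℕ<) renaming (zero to fzero)
open import Data.Fin.Subset using (Subset; _∈_)
open import Data.Bool using (Bool; true; false)
open import Data.Product using (_×_; _,_; Σ; ∃)
open import Relation.Binary.PropositionalEquality using (_≡_; _≢_)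
open import Relation.Nullary using (¬_)

addF : ∀ {n} → Fin n → Fin n → Fin n
addF {suc m} i j = fromℕ< (m%n<n (toℕ i + toℕ j) (suc m))

negF : ∀ {n} → Fin n → Fin n
negF {suc m} i = fromℕ< (m%n<n (suc m ∸ toℕ i) (suc m))

-- The dihedral group D_{2n} = ⟨ r , s ∣ rⁿ = s² = 1 , srs = r⁻¹ ⟩
-- Element (false , i) is r^i, element (true , i) is s r^i.

Dih : ℕ → Set
Dih n = Bool × Fin n

module _ {n : ℕ} where

  -- r^i r^j = r^(i+j);  r^i (s r^j) = s r^(j-i);
  -- (s r^i) r^j = s r^(i+j);  (s r^i)(s r^j) = r^(j-i)
  _·_ : Dih n → Dih n → Dih n
  (false , i) · (false , j) = false , addF i j
  (false , i) · (true  , j) = true  , addF j (negF i)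
  (true  , i) · (false , j) = true  , addF i j
  (true  , i) · (true  , j) = false , addF j (negF i)

  -- r^i ↦ r^(-i);  s r^i ↦ s r^i (reflections are involutions)
  inv : Dih n → Dih n
  inv (false , i) = false , negF i
  inv (true  , i) = true , i

module _ {m : ℕ} where

  one : Dih (suc m)
  one = false , fzero

-- Subsets of D_{2n}: a subset of the rotations and a subset of the
-- reflections (so that equal subsets are propositionally equal).

DSub : ℕ → Set
DSub n = Subset n × Subset n

_∈D_ : ∀ {n} → Dih n → DSub n → Set
(false , i) ∈D (A , B) = i ∈ A
(true  , i) ∈D (A , B) = i ∈ B

record IsSubgroup (m : ℕ) (H : DSub (suc m)) : Set where
  field
    has-one : one ∈D H
    mul-closed : ∀ x y → x ∈D H → y ∈D H → (x · y) ∈D H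
    inv-closed : ∀ x → x ∈D H → inv x ∈D H

IsTrivial : ∀ {m} → DSub (suc m) → Set
IsTrivial H = ∀ x → x ∈D H → x ≡ one

IsWhole : ∀ {m} → DSub (suc m) → Set
IsWhole H = ∀ x → x ∈D H

IsVertex : ∀ m → DSub (suc m) → Set
IsVertex m H = IsSubgroup m H × ¬ IsTrivial H × ¬ IsWhole H

Meets : ∀ {m} → DSub (suc m) → DSub (suc m) → Set
Meets H K = ∃ λ x → x ∈D H × x ∈D K × x ≢ one

-- Split graphs: a graph given by a vertex predicate V on a type and an
-- adjacency relation E (on distinct vertices) is split iff its vertex
-- set can be partitioned into a clique (C v ≡ true) and an independent
-- set (C v ≡ false).

IsSplit : {X : Set} (V : X → Set) (E : X → X → Set) → Set
IsSplit {X} V E = Σ (X → Bool) λ C →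
  (∀ u v → V u → V v → u ≢ v → C u ≡ true  → C v ≡ true  → E u v) ×
  (∀ u v → V u → V v → u ≢ v → C u ≡ false → C v ≡ false → ¬ E u v)

-- Γ(D_{2n}) is split, for n = suc m
IntersectionGraphDihIsSplit : ℕ → Set
IntersectionGraphDihIsSplit m = IsSplit (IsVertex m) Meets

-- A subgroup of D_{2p²} either contains a non-trivial rotation or consists of
-- the identity and reflections.  Every non-trivial subgroup of the cyclic
-- rotation group ℤ/p² contains its unique subgroup of order p, generated by
-- r^p, so the subgroups of the first kind form a clique.  A subgroup of the
-- second kind contains at most one reflection, since the product of two
-- reflections s r^i, s r^j is the rotation r^(j-i); hence two of them that
-- share a non-identity element coincide, and they form an independent set.
module Submission where

open import Data.Bool using (Bool; true; false)
open import Data.Fin using (Fin; toℕ; fromℕ<) renaming (zero to fzero; suc to fsuc)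
open import Data.Fin.Properties using (toℕ-fromℕ<; toℕ-injective; toℕ<n)
open import Data.Fin.Subset using (Subset; _∈_; _⊆_)
open import Data.Fin.Subset.Properties using (nonempty?; ⊆-antisym; drop-there)
open import Data.Nat
open import Data.Nat.Coprimality using (Coprime; coprime-Bézout)
open import Data.Nat.DivMod
open import Data.Nat.Divisibility using (_∣_; divides; _∣?_; ∣⇒≤)
open import Data.Nat.GCD using (module Bézout)
open import Data.Nat.Primality using (Prime; prime⇒irreducible; prime⇒nonZero; prime⇒nonTrivial)
open import Data.Nat.Properties
open import Algebra.Properties.CommutativeSemigroup *-commutativeSemigroup using (xy∙z≈xz∙y)
open import Data.Nat.Tactic.RingSolver using (solve-∀)
open import Data.Product using (_,_; ∃; proj₂)
open import Data.Sum using (inj₁; inj₂)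
open import Data.Vec using (_∷_; there)
open import Function using (_∘_)
open import Relation.Binary.PropositionalEquality
open import Relation.Nullary using (¬_; Dec; yes; no; does; contradiction)

open import Defs

∤⇒coprime : ∀ {p a} → Prime p → ¬ p ∣ a → Coprime a p
∤⇒coprime pr p∤a (d∣a , d∣p) with prime⇒irreducible pr d∣p
... | inj₁ d≡1 = d≡1
... | inj₂ refl = contradiction d∣a p∤a

modInverse : ∀ {a n} .{{_ : NonZero n}} → 1 < n → Coprime a n → ∃ λ k → k * a % n ≡ 1
modInverse {a} {n@(suc q)} 1<n c with coprime-Bézout c
... | Bézout.+- x y eq = x , (begin
  x * a % n            ≡⟨ cong (_% n) eq ⟨
  (1 + y * n) % n      ≡⟨ [m+kn]%n≡m%n 1 y n ⟩
  1 % n                ≡⟨ m<n⇒m%n≡m 1<n ⟩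
  1                    ∎)
  where open ≡-Reasoning
... | Bézout.-+ x y eq = q * x , (begin
  q * x * a % n              ≡⟨ [m+n]%n≡m%n (q * x * a) n ⟨
  (q * x * a + n) % n        ≡⟨ cong (_% n) (shift q x a) ⟩
  (1 + q * (1 + x * a)) % n  ≡⟨ cong (λ t → (1 + q * t) % n) eq ⟩
  (1 + q * (y * n)) % n      ≡⟨ cong (λ t → (1 + t) % n) (*-assoc q y n) ⟨
  (1 + q * y * n) % n        ≡⟨ [m+kn]%n≡m%n 1 (q * y) n ⟩
  1 % n                      ≡⟨ m<n⇒m%n≡m 1<n ⟩
  1                          ∎)
  where open ≡-Reasoning
        -- q = n - 1 ≡ -1 (mod n), so 1 + x a ≡ 0 gives q x a ≡ 1
        shift : ∀ q x a → q * x * a + suc q ≡ 1 + q * (1 + x * a)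
        shift = solve-∀

%≡1⇒[*n]%[n*n]≡n : ∀ {k n} .{{_ : NonZero n}} .{{_ : NonZero (n * n)}} →
                   k % n ≡ 1 → k * n % (n * n) ≡ n
%≡1⇒[*n]%[n*n]≡n {k} {n} k%n≡1 = begin
  k * n % (n * n)  ≡⟨ m%n*o≡m*o%[n*o] k n n ⟨
  k % n * n        ≡⟨ cong (_* n) k%n≡1 ⟩
  1 * n            ≡⟨ *-identityˡ n ⟩
  n                ∎
  where open ≡-Reasoning

∤-cofactor : ∀ {a p i} → i ≡ a * p → 0 < i → i < p * p → ¬ p ∣ a
∤-cofactor {a@(suc _)} {p} refl _ i<pp p∣a = <⇒≱ i<pp (*-monoˡ-≤ p (∣⇒≤ p∣a))

∃[k*i%n≡p] : ∀ {p n i} .{{_ : NonZero n}} → Prime p → n ≡ p * p →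
             0 < i → i < n → ∃ λ k → k * i % n ≡ p
∃[k*i%n≡p] {p} {_} {i} pr refl 0<i i<n = cases (p ∣? i)
  where
  open ≡-Reasoning
  instance _ = prime⇒nonZero pr
  1<p = nonTrivial⇒n>1 p {{prime⇒nonTrivial pr}}

  cases : Dec (p ∣ i) → ∃ λ k → k * i % (p * p) ≡ p
  cases (yes (divides a i≡ap)) =
    let k , ka%p≡1 = modInverse 1<p (∤⇒coprime pr (∤-cofactor i≡ap 0<i i<n)) in
    k , (begin
      k * i % (p * p)        ≡⟨ cong (λ j → k * j % (p * p)) i≡ap ⟩
      k * (a * p) % (p * p)  ≡⟨ cong (_% (p * p)) (*-assoc k a p) ⟨
      k * a * p % (p * p)    ≡⟨ %≡1⇒[*n]%[n*n]≡n ka%p≡1 ⟩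
      p                      ∎)
  cases (no p∤i) =
    let k , ki%p≡1 = modInverse 1<p (∤⇒coprime pr p∤i) in
    k * p , (begin
      k * p * i % (p * p)  ≡⟨ cong (_% (p * p)) (xy∙z≈xz∙y k p i) ⟩
      k * i * p % (p * p)  ≡⟨ %≡1⇒[*n]%[n*n]≡n ki%p≡1 ⟩
      p                    ∎)

[m+n%d]%d≡[m+n]%d : ∀ m n d .{{_ : NonZero d}} → (m + n % d) % d ≡ (m + n) % d
[m+n%d]%d≡[m+n]%d m n d = begin
  (m + n % d) % d          ≡⟨ %-distribˡ-+ m (n % d) d ⟩
  (m % d + n % d % d) % d  ≡⟨ cong (λ t → (m % d + t) % d) (m%n%n≡m%n n d) ⟩
  (m % d + n % d) % d      ≡⟨ %-distribˡ-+ m n d ⟨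
  (m + n) % d              ∎
  where open ≡-Reasoning

[m+[n∸k]]%n≡0⇒m≡k : ∀ {m k n} .{{_ : NonZero n}} → m < n → k < n → (m + (n ∸ k)) % n ≡ 0 → m ≡ k
[m+[n∸k]]%n≡0⇒m≡k {m} {k} {n} m<n k<n ≡0 with k ≤? m
... | yes k≤m = ≤-antisym (m∸n≡0⇒m≤n m∸k≡0) k≤m
  where
  m∸k≡0 : m ∸ k ≡ 0
  m∸k≡0 = begin
    m ∸ k              ≡⟨ m<n⇒m%n≡m (≤-<-trans (m∸n≤m m k) m<n) ⟨
    (m ∸ k) % n        ≡⟨ [m+n]%n≡m%n (m ∸ k) n ⟨
    (m ∸ k + n) % n    ≡⟨ cong (_% n) (+-∸-comm n k≤m) ⟨
    (m + n ∸ k) % n    ≡⟨ cong (_% n) (+-∸-assoc m (<⇒≤ k<n)) ⟩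
    (m + (n ∸ k)) % n  ≡⟨ ≡0 ⟩
    0                  ∎
    where open ≡-Reasoning
... | no k≰m = contradiction (m+n≡0⇒n≡0 m m+[n∸k]≡0) (m<n⇒n≢0 (m<n⇒0<n∸m k<n))
  where
  m+[n∸k]<n : m + (n ∸ k) < n
  m+[n∸k]<n = subst (m + (n ∸ k) <_) (m+[n∸m]≡n (<⇒≤ k<n)) (+-monoˡ-< (n ∸ k) (≰⇒> k≰m))
  m+[n∸k]≡0 : m + (n ∸ k) ≡ 0
  m+[n∸k]≡0 = trans (sym (m<n⇒m%n≡m m+[n∸k]<n)) ≡0

module _ {m : ℕ} where

  toℕ-addF : (i j : Fin (suc m)) → toℕ (addF i j) ≡ (toℕ i + toℕ j) % suc m
  toℕ-addF i j = toℕ-fromℕ< _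

  toℕ-addF-negF : (i j : Fin (suc m)) → toℕ (addF j (negF i)) ≡ (toℕ j + (suc m ∸ toℕ i)) % suc m
  toℕ-addF-negF i j = trans (toℕ-addF j (negF i))
    (trans (cong (λ t → (toℕ j + t) % suc m) (toℕ-fromℕ< _)) ([m+n%d]%d≡[m+n]%d (toℕ j) _ (suc m)))

  addF-negF≡0⇒≡ : (i j : Fin (suc m)) → addF j (negF i) ≡ fzero → j ≡ i
  addF-negF≡0⇒≡ i j j-i≡0 = toℕ-injective
    ([m+[n∸k]]%n≡0⇒m≡k (toℕ<n j) (toℕ<n i) (trans (sym (toℕ-addF-negF i j)) (cong toℕ j-i≡0)))

  scaleF : ℕ → Fin (suc m) → Fin (suc m)
  scaleF zero    i = fzero
  scaleF (suc k) i = addF i (scaleF k i)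

  toℕ-scaleF : ∀ k (i : Fin (suc m)) → toℕ (scaleF k i) ≡ k * toℕ i % suc m
  toℕ-scaleF zero    i = refl
  toℕ-scaleF (suc k) i = begin
    toℕ (addF i (scaleF k i))             ≡⟨ toℕ-addF i (scaleF k i) ⟩
    (toℕ i + toℕ (scaleF k i)) % suc m    ≡⟨ cong (λ t → (toℕ i + t) % suc m) (toℕ-scaleF k i) ⟩
    (toℕ i + k * toℕ i % suc m) % suc m   ≡⟨ [m+n%d]%d≡[m+n]%d (toℕ i) (k * toℕ i) (suc m) ⟩
    (toℕ i + k * toℕ i) % suc m           ∎
    where open ≡-Reasoning

-- The head of the rotation subset is r⁰ = 1, so its tail holds the
-- non-identity rotations.
hasRotation : ∀ {m} → DSub (suc m) → Bool
hasRotation (_ ∷ A , _) = does (nonempty? A)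

hasRotation⇒∃∈ : ∀ {m} {A B : Subset (suc m)} → hasRotation (A , B) ≡ true → ∃ λ i → fsuc i ∈ A
hasRotation⇒∃∈ {A = _ ∷ A} _ with nonempty? A
... | yes (i , i∈A) = i , there i∈A

¬hasRotation⇒≡0 : ∀ {m} {A B : Subset (suc m)} → hasRotation (A , B) ≡ false → ∀ {i} → i ∈ A → i ≡ fzero
¬hasRotation⇒≡0 _ {fzero} _ = refl
¬hasRotation⇒≡0 {A = _ ∷ A} _ {fsuc i} i∈A with nonempty? A
... | no ¬ne = contradiction (i , drop-there i∈A) ¬ne

module _ {m} {A B : Subset (suc m)} (H : IsSubgroup m (A , B)) where
  open IsSubgroup H

  scaleF-∈ : ∀ k {i} → i ∈ A → scaleF k i ∈ A
  scaleF-∈ zero    _   = has-one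
  scaleF-∈ (suc k) i∈A = mul-closed (false , _) (false , _) i∈A (scaleF-∈ k i∈A)

  rotation-∈⇒rᵖ-∈ : ∀ {p P i} → Prime p → suc m ≡ p * p → toℕ P ≡ p → fsuc i ∈ A → P ∈ A
  rotation-∈⇒rᵖ-∈ {p} {P} {i} pr n≡pp P≡p i∈A
    with k , k*i%n≡p ← ∃[k*i%n≡p] pr n≡pp (s≤s z≤n) (toℕ<n (fsuc i))
    = subst (_∈ A) (toℕ-injective (begin
        toℕ (scaleF k (fsuc i))       ≡⟨ toℕ-scaleF k (fsuc i) ⟩
        k * toℕ (fsuc i) % suc m      ≡⟨ k*i%n≡p ⟩
        p                             ≡⟨ P≡p ⟨
        toℕ P                         ∎))
      (scaleF-∈ k i∈A)
    where open ≡-Reasoning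

  module _ (noRotation : hasRotation (A , B) ≡ false) where

    rotations-⊆ : ∀ {A′ B′ : Subset (suc m)} → IsSubgroup m (A′ , B′) → A ⊆ A′
    rotations-⊆ H′ i∈A = subst (_∈ _) (sym (¬hasRotation⇒≡0 noRotation i∈A)) (IsSubgroup.has-one H′)

    reflection-unique : ∀ {i j} → i ∈ B → j ∈ B → j ≡ i
    reflection-unique {i} {j} i∈B j∈B =
      addF-negF≡0⇒≡ i j (¬hasRotation⇒≡0 noRotation (mul-closed (true , i) (true , j) i∈B j∈B))

    reflections-⊆ : ∀ {i} {B′ : Subset (suc m)} → i ∈ B → i ∈ B′ → B ⊆ B′
    reflections-⊆ i∈B i∈B′ j∈B = subst (_∈ _) (sym (reflection-unique i∈B j∈B)) i∈B′

meets⇒≡ : ∀ {m} {A B A′ B′ : Subset (suc m)} →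
          IsSubgroup m (A , B) → IsSubgroup m (A′ , B′) →
          hasRotation (A , B) ≡ false → hasRotation (A′ , B′) ≡ false →
          Meets (A , B) (A′ , B′) → (A , B) ≡ (A′ , B′)
meets⇒≡ H H′ noRot noRot′ ((false , i) , i∈A , _ , r≢1) =
  contradiction (cong (false ,_) (¬hasRotation⇒≡0 noRot i∈A)) r≢1
meets⇒≡ H H′ noRot noRot′ ((true , i) , i∈B , i∈B′ , _) = cong₂ _,_
  (⊆-antisym (rotations-⊆ H noRot H′) (rotations-⊆ H′ noRot′ H))
  (⊆-antisym (reflections-⊆ H noRot i∈B i∈B′) (reflections-⊆ H′ noRot′ i∈B′ i∈B))

corollary2p10 : (p m : ℕ) → Prime p → suc m ≡ p * p →
    IntersectionGraphDihIsSplit m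
corollary2p10 p m pr n≡pp = hasRotation , clique , independent
  where
  instance _ = prime⇒nonZero pr
  1<p = nonTrivial⇒n>1 p {{prime⇒nonTrivial pr}}

  rᵖ : Dih (suc m)
  rᵖ = false , fromℕ< (subst (p <_) (sym n≡pp) (m<m*n p p 1<p))

  rᵖ≢1 : rᵖ ≢ one
  rᵖ≢1 rᵖ≡1 = m<n⇒n≢0 1<p (trans (sym (toℕ-fromℕ< _)) (cong (toℕ ∘ proj₂) rᵖ≡1))

  clique : ∀ u v → IsVertex m u → IsVertex m v → u ≢ v →
           hasRotation u ≡ true → hasRotation v ≡ true → Meets u v
  clique (A , B) (A′ , B′) (H , _) (H′ , _) _ rot rot′ =
    rᵖ , rotation-∈⇒rᵖ-∈ H  pr n≡pp (toℕ-fromℕ< _) (proj₂ (hasRotation⇒∃∈ rot))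
       , rotation-∈⇒rᵖ-∈ H′ pr n≡pp (toℕ-fromℕ< _) (proj₂ (hasRotation⇒∃∈ rot′))
       , rᵖ≢1

  independent : ∀ u v → IsVertex m u → IsVertex m v → u ≢ v →
                hasRotation u ≡ false → hasRotation v ≡ false → ¬ Meets u v
  independent (A , B) (A′ , B′) (H , _) (H′ , _) u≢v noRot noRot′ =
    u≢v ∘ meets⇒≡ H H′ noRot noRot′
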